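{- Let $G$ be the $(n\times n)$-grid and let $Q\subseteq V_1$. If $Q'$ is obtained from $Q$ by the down-right shifting (respectively, by the down-left shifting), then $\delta(Q')\le\delta(Q)$.
   Context: The $(n\times n)$-grid $G$ has vertex set $\{(x,y): x,y\in\mathbb Z,\ 1\le x,y\le n\}$, with $(x,y)$ adjacent to $(x',y')$ iff $|x-x'|+|y-y'|=1$. $V_1=\{(x,y): x+y \text{ even}\}$, $V_2=\{(x,y): x+y\text{ odd}\}$. For $S\subseteq V(G)$, $N(S)=\bigcup_{v\in S}N(v)\setminus S$ and $\delta(S)=|N(S)|$. For each integer $i$ let $U_i=\{(x,y)\in V(G): x+y=i\}$ and $W_i=\{(x,y)\in V(G): x-y=i\}$, each with its vertices ordered by increasing $y$-coordinate. For $Q\subseteq V_1$, the down-right shifting of $Q$ is the set $Q'$ obtained by replacing, for each even $i$, the $r=|U_i\cap Q|$ vertices of $U_i\cap Q$ by the first $r$ vertices of $U_i$ (those with the $r$ smallest $y$-coordinates). The down-left shifting is defined in the same way with the sets $W_i$ ($i$ even) in place of $U_i$. -}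

module Defs where

open import Data.Nat using (ℕ; zero; suc; _+_; _≤_; _<ᵇ_; ∣_-_∣)
open import Data.Nat.Base using (_≡ᵇ_)
open import Data.Nat.Properties using ()
open import Data.Fin using (Fin; toℕ)
open import Data.Bool using (Bool; true; false; _∧_; _∨_; not; if_then_else_)
open import Data.List using (List; []; _∷_; concatMap; map; allFin)
open import Data.Product using (_×_; _,_; proj₁; proj₂)
open import Relation.Binary.PropositionalEquality using (_≡_)

-- Vertices of the (n × n)-grid: (i , j) : Fin n × Fin n represents the
-- point (x , y) = (toℕ i + 1 , toℕ j + 1), so 1 ≤ x , y ≤ n.
Vertex : ℕ → Set
Vertex n = Fin n × Fin n

xc : ∀ {n} → Vertex n → ℕ
xc v = suc (toℕ (proj₁ v))

yc : ∀ {n} → Vertex n → ℕ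
yc v = suc (toℕ (proj₂ v))

vertices : (n : ℕ) → List (Vertex n)
vertices n = concatMap (λ i → map (λ j → (i , j)) (allFin n)) (allFin n)

VSet : ℕ → Set
VSet n = Vertex n → Bool

countᵇ : ∀ {A : Set} → (A → Bool) → List A → ℕ
countᵇ p [] = 0
countᵇ p (a ∷ as) = if p a then suc (countᵇ p as) else countᵇ p as

card : ∀ {n} → VSet n → ℕ
card {n} S = countᵇ S (vertices n)

evenᵇ : ℕ → Bool
evenᵇ zero = true
evenᵇ (suc k) = not (evenᵇ k)

adjᵇ : ∀ {n} → Vertex n → Vertex n → Bool
adjᵇ u v = (∣ xc u - xc v ∣ + ∣ yc u - yc v ∣) ≡ᵇ 1

anyᵇ : ∀ {A : Set} → (A → Bool) → List A → Bool
anyᵇ p [] = false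
anyᵇ p (a ∷ as) = p a ∨ anyᵇ p as

N : ∀ {n} → VSet n → VSet n
N {n} S v = not (S v) ∧ anyᵇ (λ u → S u ∧ adjᵇ u v) (vertices n)

δ : ∀ {n} → VSet n → ℕ
δ S = card (N S)

V₁ : ∀ {n} → VSet n
V₁ v = evenᵇ (xc v + yc v)

_⊆_ : ∀ {n} → VSet n → VSet n → Set
S ⊆ T = ∀ v → S v ≡ true → T v ≡ true

sameUᵇ : ∀ {n} → Vertex n → Vertex n → Bool
sameUᵇ u v = (xc u + yc u) ≡ᵇ (xc v + yc v)

-- Same antidiagonal W_i : x - y = x' - y' (as integers), i.e. x + y' = x' + y.
sameWᵇ : ∀ {n} → Vertex n → Vertex n → Bool
sameWᵇ u v = (xc u + yc v) ≡ᵇ (xc v + yc u)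

-- Index parity: for both U_i (i = x+y) and W_i (i = x-y), i is even iff x + y is even.
-- For v on a line L with even index: v ∈ Q' iff the position of v in L
-- (number of vertices of L with smaller y-coordinate) is < r = |L ∩ Q|,
-- i.e. v is among the first r vertices of L ordered by increasing y.
shift : ∀ {n} → (Vertex n → Vertex n → Bool) → VSet n → VSet n
shift {n} same Q v =
  if evenᵇ (xc v + yc v)
  then (countᵇ (λ u → same u v ∧ (yc u <ᵇ yc v)) (vertices n)
          <ᵇ countᵇ (λ u → same u v ∧ Q u) (vertices n))
  else Q v

downRight : ∀ {n} → VSet n → VSet n
downRight = shift sameUᵇ

downLeft : ∀ {n} → VSet n → VSet n
downLeft = shift sameWᵇ

module Submission where

-- Since Q ⊆ V₁, N(Q) consists of odd vertices, and a vertex of an odd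
-- diagonal U_t has its neighbours on U_{t-1} and U_{t+1}.  Read as a path,
-- U_t ∩ N(Q) is the union of the sets of positions touched by the traces of
-- Q on U_{t-1} and U_{t+1}.  Each of these lines is one vertex longer than
-- U_t (covering its m positions and one more) or one shorter (sitting
-- strictly inside); by a 1-dimensional isoperimetric fact an initial segment
-- of r points touches the fewest positions, min(m, r) resp. min(m, r + 1)
-- (for r > 0).  Down-right shifting replaces every trace by an initial
-- segment of the same size, so no line of N(Q) grows.  Down-left shifting
-- is down-right shifting conjugated by the reflection x ↦ n + 1 - x, which
-- exchanges the W- and U-lines and preserves the boundary count up to
-- swapping the two parity classes.

open import Defs
open import Data.Nat using (ℕ; _≤_)
open import Data.Product using (_×_; _,_)

module BoolFacts where

  open import Data.Nat
  open import Data.Nat.Properties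
  open import Data.Bool using (Bool; true; false; _∧_; _∨_; T)
  open import Data.Product using (_×_; _,_)
  open import Data.Sum using (_⊎_; inj₁; inj₂)
  open import Data.Unit using (tt)
  open import Data.Empty using (⊥; ⊥-elim)
  open import Relation.Binary.PropositionalEquality
  open import Relation.Nullary using (¬_)

  private
    T⇒true : ∀ {b} → T b → b ≡ true
    T⇒true {true} _ = refl

    true⇒T : ∀ {b} → b ≡ true → T b
    true⇒T refl = tt

  <ᵇ-true : ∀ {m n} → m < n → (m <ᵇ n) ≡ true
  <ᵇ-true p = T⇒true (<⇒<ᵇ p)

  <ᵇ-sound : ∀ m n → (m <ᵇ n) ≡ true → m < n
  <ᵇ-sound m n e = <ᵇ⇒< m n (true⇒T e)

  ≤ᵇ-true : ∀ {m n} → m ≤ n → (m ≤ᵇ n) ≡ true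
  ≤ᵇ-true p = T⇒true (≤⇒≤ᵇ p)

  ≤ᵇ-sound : ∀ m n → (m ≤ᵇ n) ≡ true → m ≤ n
  ≤ᵇ-sound m n e = ≤ᵇ⇒≤ m n (true⇒T e)

  ≡ᵇ-true : ∀ {m n} → m ≡ n → (m ≡ᵇ n) ≡ true
  ≡ᵇ-true {m} {n} p = T⇒true (≡⇒≡ᵇ m n p)

  ≡ᵇ-sound : ∀ m n → (m ≡ᵇ n) ≡ true → m ≡ n
  ≡ᵇ-sound m n e = ≡ᵇ⇒≡ m n (true⇒T e)

  not-true : ∀ {b} → (b ≡ true → ⊥) → b ≡ false
  not-true {true} h = ⊥-elim (h refl)
  not-true {false} h = refl

  <ᵇ-false : ∀ {m n} → ¬ (m < n) → (m <ᵇ n) ≡ false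
  <ᵇ-false {m} {n} h = not-true (λ e → h (<ᵇ-sound m n e))

  ≤ᵇ-false : ∀ {m n} → ¬ (m ≤ n) → (m ≤ᵇ n) ≡ false
  ≤ᵇ-false {m} {n} h = not-true (λ e → h (≤ᵇ-sound m n e))

  ≡ᵇ-false : ∀ {m n} → ¬ (m ≡ n) → (m ≡ᵇ n) ≡ false
  ≡ᵇ-false {m} {n} h = not-true (λ e → h (≡ᵇ-sound m n e))

  ∨-split : ∀ {a b} → (a ∨ b) ≡ true → a ≡ true ⊎ b ≡ true
  ∨-split {true} e = inj₁ refl
  ∨-split {false} e = inj₂ e

  ∨-inl : ∀ {a} b → a ≡ true → (a ∨ b) ≡ true
  ∨-inl b refl = refl

  ∨-inr : ∀ a {b} → b ≡ true → (a ∨ b) ≡ true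
  ∨-inr true e = refl
  ∨-inr false e = e

  ∧-split : ∀ {a b} → (a ∧ b) ≡ true → a ≡ true × b ≡ true
  ∧-split {true} {true} e = refl , refl

  ∧-intro : ∀ {a b} → a ≡ true → b ≡ true → (a ∧ b) ≡ true
  ∧-intro refl refl = refl

  bool-≡ : ∀ {a b} → (a ≡ true → b ≡ true) → (b ≡ true → a ≡ true) → a ≡ b
  bool-≡ {true} h g = sym (h refl)
  bool-≡ {false} {true} h g = g refl
  bool-≡ {false} {false} h g = refl

module FiniteSums where

  open import Data.Nat
  open import Data.Nat.Properties
  open import Data.Bool using (Bool; true; false; _∧_)
  open import Data.Bool.Properties using (∧-zeroʳ)
  open import Data.Product using (_×_; _,_; ∃)
  open import Relation.Binary.PropositionalEquality
  open import Algebra.Properties.CommutativeSemigroup +-commutativeSemigroup using (interchange; x∙yz≈y∙xz)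
  open BoolFacts

  Σ< : ℕ → (ℕ → ℕ) → ℕ
  Σ< zero f = 0
  Σ< (suc n) f = f 0 + Σ< n (λ k → f (suc k))

  ⟦_⟧ : Bool → ℕ
  ⟦ true ⟧ = 1
  ⟦ false ⟧ = 0

  Σ<-cong : ∀ n {f g : ℕ → ℕ} → (∀ k → k < n → f k ≡ g k) → Σ< n f ≡ Σ< n g
  Σ<-cong zero h = refl
  Σ<-cong (suc n) h = cong₂ _+_ (h 0 z<s) (Σ<-cong n (λ k k<n → h (suc k) (s<s k<n)))

  Σ<-mono : ∀ n {f g : ℕ → ℕ} → (∀ k → k < n → f k ≤ g k) → Σ< n f ≤ Σ< n g
  Σ<-mono zero h = z≤n
  Σ<-mono (suc n) h = +-mono-≤ (h 0 z<s) (Σ<-mono n (λ k k<n → h (suc k) (s<s k<n)))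

  Σ<-zero : ∀ n {f : ℕ → ℕ} → (∀ k → k < n → f k ≡ 0) → Σ< n f ≡ 0
  Σ<-zero n h = trans (Σ<-cong n h) (zeros n)
    where
    zeros : ∀ n → Σ< n (λ _ → 0) ≡ 0
    zeros zero = refl
    zeros (suc n) = zeros n

  Σ<-+ : ∀ n (f g : ℕ → ℕ) → Σ< n (λ k → f k + g k) ≡ Σ< n f + Σ< n g
  Σ<-+ zero f g = refl
  Σ<-+ (suc n) f g =
    trans (cong (f 0 + g 0 +_) (Σ<-+ n (λ k → f (suc k)) (λ k → g (suc k)))) (interchange (f 0) (g 0) _ _)

  Σ<-swap : ∀ n m (f : ℕ → ℕ → ℕ) → Σ< n (λ i → Σ< m (λ j → f i j)) ≡ Σ< m (λ j → Σ< n (λ i → f i j))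
  Σ<-swap zero m f = sym (Σ<-zero m (λ _ _ → refl))
  Σ<-swap (suc n) m f =
    trans (cong (Σ< m (λ j → f 0 j) +_) (Σ<-swap n m (λ i j → f (suc i) j)))
          (sym (Σ<-+ m (λ j → f 0 j) (λ j → Σ< n (λ i → f (suc i) j))))

  Σ<-split : ∀ L k (f : ℕ → ℕ) → Σ< (L + k) f ≡ Σ< L f + Σ< k (λ p → f (L + p))
  Σ<-split zero k f = refl
  Σ<-split (suc L) k f = trans (cong (f 0 +_) (Σ<-split L k (λ j → f (suc j)))) (sym (+-assoc (f 0) _ _))

  Σ<-split≤ : ∀ L n (f : ℕ → ℕ) → L ≤ n → Σ< n f ≡ Σ< L f + Σ< (n ∸ L) (λ p → f (L + p))
  Σ<-split≤ L n f h = trans (cong (λ z → Σ< z f) (sym (m+[n∸m]≡n h))) (Σ<-split L (n ∸ L) f)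

  Σ<-last : ∀ n (f : ℕ → ℕ) → Σ< (suc n) f ≡ f n + Σ< n f
  Σ<-last zero f = refl
  Σ<-last (suc n) f = trans (cong (f 0 +_) (Σ<-last n (λ k → f (suc k)))) (x∙yz≈y∙xz (f 0) (f (suc n)) _)

  Σ<-length-mono : ∀ {k k'} (f : ℕ → ℕ) → k ≤ k' → Σ< k f ≤ Σ< k' f
  Σ<-length-mono {k} {k'} f k≤k' =
    subst (Σ< k f ≤_) (sym (Σ<-split≤ k k' f k≤k')) (m≤m+n _ _)

  Σ<-reverse : ∀ n (f : ℕ → ℕ) → Σ< n (λ k → f (n ∸ suc k)) ≡ Σ< n f
  Σ<-reverse zero f = refl
  Σ<-reverse (suc n) f = trans (cong (f n +_) (Σ<-reverse n f)) (sym (Σ<-last n f))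

  ⟦⟧-mono : ∀ {b b'} → (b ≡ true → b' ≡ true) → ⟦ b ⟧ ≤ ⟦ b' ⟧
  ⟦⟧-mono {false} h = z≤n
  ⟦⟧-mono {true} h rewrite h refl = ≤-refl

  Σ<-positive : ∀ n (F : ℕ → ℕ) → 0 < Σ< n F → ∃ λ k → k < n × 0 < F k
  Σ<-positive (suc n) F h with F 0 in eq
  ... | suc x = 0 , z<s , subst (0 <_) (sym eq) z<s
  ... | zero with Σ<-positive n (λ k → F (suc k)) h
  ... | k , k<n , e = suc k , s<s k<n , e

  Σ<-term : ∀ n (F : ℕ → ℕ) k → k < n → 0 < F k → 0 < Σ< n F
  Σ<-term (suc n) F zero k<n e = ≤-trans e (m≤m+n _ _)
  Σ<-term (suc n) F (suc k) (s<s k<n) e = <-≤-trans (Σ<-term n (λ k → F (suc k)) k k<n e) (m≤n+m _ _)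

  ⟦⟧-positive : ∀ {b} → 0 < ⟦ b ⟧ → b ≡ true
  ⟦⟧-positive {true} _ = refl

  Σ<-initial : ∀ m K → Σ< m (λ p → ⟦ p <ᵇ K ⟧) ≡ m ⊓ K
  Σ<-initial zero K = refl
  Σ<-initial (suc m) zero = Σ<-zero m (λ _ _ → refl)
  Σ<-initial (suc m) (suc K) = cong suc (Σ<-initial m K)

  Σ<-count-≤ : ∀ n (b : ℕ → Bool) → Σ< n (λ k → ⟦ b k ⟧) ≤ n
  Σ<-count-≤ zero b = z≤n
  Σ<-count-≤ (suc n) b = +-mono-≤ (bit (b 0)) (Σ<-count-≤ n (λ k → b (suc k)))
    where
    bit : ∀ x → ⟦ x ⟧ ≤ 1
    bit true = ≤-refl
    bit false = z≤n

  Σ<-point : ∀ n c (Y : ℕ → Bool) → Σ< n (λ i → ⟦ (i ≡ᵇ c) ∧ Y i ⟧) ≡ ⟦ (c <ᵇ n) ∧ Y c ⟧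
  Σ<-point zero c Y = refl
  Σ<-point (suc n) zero Y = trans (cong (⟦ Y 0 ⟧ +_) (Σ<-zero n (λ _ _ → refl))) (+-identityʳ _)
  Σ<-point (suc n) (suc c) Y = Σ<-point n c (λ i → Y (suc i))

  Σ<-window : ∀ n lo hi (Z : ℕ → Bool) → lo ≤ hi → hi ≤ n →
              Σ< n (λ b → ⟦ ((lo ≤ᵇ b) ∧ (b <ᵇ hi)) ∧ Z b ⟧) ≡ Σ< (hi ∸ lo) (λ p → ⟦ Z (lo + p) ⟧)
  Σ<-window n lo hi Z lo≤hi hi≤n = begin
      Σ< n F
    ≡⟨ Σ<-split≤ lo n F (≤-trans lo≤hi hi≤n) ⟩
      Σ< lo F + Σ< (n ∸ lo) (λ p → F (lo + p))
    ≡⟨ cong (_+ Σ< (n ∸ lo) (λ p → F (lo + p)))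
            (Σ<-zero lo (λ b b<lo → cong (λ z → ⟦ (z ∧ (b <ᵇ hi)) ∧ Z b ⟧) (≤ᵇ-false (<⇒≱ b<lo)))) ⟩
      Σ< (n ∸ lo) (λ p → F (lo + p))
    ≡⟨ Σ<-split≤ (hi ∸ lo) (n ∸ lo) (λ p → F (lo + p)) (∸-monoˡ-≤ lo hi≤n) ⟩
      Σ< (hi ∸ lo) (λ p → F (lo + p)) + Σ< (n ∸ lo ∸ (hi ∸ lo)) (λ q → F (lo + (hi ∸ lo + q)))
    ≡⟨ cong₂ _+_ (Σ<-cong (hi ∸ lo) (λ p p< → cong ⟦_⟧ (inside p p<)))
                 (Σ<-zero (n ∸ lo ∸ (hi ∸ lo)) (λ q _ → cong (λ z → ⟦ z ∧ Z (lo + (hi ∸ lo + q)) ⟧) (outside q))) ⟩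
      Σ< (hi ∸ lo) (λ p → ⟦ Z (lo + p) ⟧) + 0
    ≡⟨ +-identityʳ _ ⟩
      Σ< (hi ∸ lo) (λ p → ⟦ Z (lo + p) ⟧) ∎
    where
    open ≡-Reasoning
    F : ℕ → ℕ
    F b = ⟦ ((lo ≤ᵇ b) ∧ (b <ᵇ hi)) ∧ Z b ⟧
    inside : ∀ p → p < hi ∸ lo → (((lo ≤ᵇ lo + p) ∧ (lo + p <ᵇ hi)) ∧ Z (lo + p)) ≡ Z (lo + p)
    inside p p< rewrite ≤ᵇ-true (m≤m+n lo p)
                      | <ᵇ-true (subst (lo + p <_) (m+[n∸m]≡n lo≤hi) (+-monoʳ-< lo p<)) = refl
    outside : ∀ q → ((lo ≤ᵇ lo + (hi ∸ lo + q)) ∧ (lo + (hi ∸ lo + q) <ᵇ hi)) ≡ false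
    outside q rewrite <ᵇ-false {lo + (hi ∸ lo + q)} {hi}
                        (≤⇒≯ (subst (_≤ lo + (hi ∸ lo + q)) (m+[n∸m]≡n lo≤hi) (+-monoʳ-≤ lo (m≤m+n _ q)))) = ∧-zeroʳ _

-- A set of positions S : ℕ → Bool lies on
-- a path next to a second path whose position p is adjacent to positions p
-- and p + 1 of the first ("S touches p").  Among all sets of a given size,
-- an initial segment touches the fewest positions of a window [0, m).
module PathNeighbourhood where

  open import Data.Nat
  open import Data.Nat.Properties
  open import Data.Bool using (Bool; true; false; _∨_)
  open import Data.Bool.Properties using (∨-zeroʳ; ∨-identityʳ)
  open import Data.Sum using (inj₁; inj₂)
  open import Relation.Binary.PropositionalEquality
  open BoolFacts
  open FiniteSums

  touches : (ℕ → Bool) → ℕ → Bool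
  touches S p = S p ∨ S (suc p)

  size : (ℕ → Bool) → ℕ → ℕ
  size S k = Σ< k (λ q → ⟦ S q ⟧)

  nbhd : (ℕ → Bool) → ℕ → ℕ
  nbhd S m = Σ< m (λ p → ⟦ touches S p ⟧)

  -- r + 1 if r is positive, 0 otherwise: the neighbourhood size of a
  -- nonempty segment of r positions lying strictly inside the window
  grow : ℕ → ℕ
  grow zero = zero
  grow (suc r) = suc (suc r)

  grow-mono : ∀ {r r'} → r ≤ r' → grow r ≤ grow r'
  grow-mono {zero} h = z≤n
  grow-mono {suc r} {suc r'} (s≤s h) = s≤s (s≤s h)

  -- the arithmetic step of nbhd-shorter: a new point adds to both sides
  grow-≤⇒≤ : ∀ s e b → grow s ≤ ⟦ b ⟧ + e → s ≤ e
  grow-≤⇒≤ zero e b h = z≤n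
  grow-≤⇒≤ (suc s) e false (s≤s h) = m≤n⇒m≤1+n h
  grow-≤⇒≤ (suc s) e true (s≤s h) = h

  size-≤ : ∀ S m → S m ≡ false → size S (suc m) ≤ m
  size-≤ S m Sm = subst (_≤ m) (sym (trans (Σ<-last m _) (cong (λ b → ⟦ b ⟧ + size S m) Sm)))
                        (Σ<-count-≤ m S)

  -- S spread over the positions 0 … m (a line one longer than the window):
  -- S touches at least min(m, |S|) positions of [0, m).
  nbhd-longer : ∀ S m → m ⊓ size S (suc m) ≤ nbhd S m
  nbhd-longer S zero = z≤n
  nbhd-longer S (suc m)
    rewrite Σ<-last (suc m) (λ q → ⟦ S q ⟧) | Σ<-last m (λ p → ⟦ touches S p ⟧)
    with S (suc m) | S m in Sm≡ | nbhd-longer S m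
  ... | true | b | ih rewrite ∨-zeroʳ b = s≤s ih
  ... | false | true | ih = ≤-trans (⊓-monoʳ-≤ (suc m) (n≤1+n _)) (s≤s ih)
  ... | false | false | ih
    rewrite m≥n⇒m⊓n≡n (m≤n⇒m≤1+n (size-≤ S m Sm≡)) | m≥n⇒m⊓n≡n (size-≤ S m Sm≡) = ih

  -- S spread over the positions 1 … m - 1 (a line one shorter than the
  -- window, sitting inside it): S touches at least grow |S| positions.
  nbhd-shorter : ∀ S → S 0 ≡ false → ∀ m → S m ≡ false → grow (size S (suc m)) ≤ nbhd S m
  nbhd-shorter S S0 m Sm = subst (λ b → grow (size S (suc m)) ≤ ⟦ b ⟧ + nbhd S m) Sm (invariant m)
    where
    invariant : ∀ k → grow (size S (suc k)) ≤ ⟦ S k ⟧ + nbhd S k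
    invariant zero rewrite S0 = z≤n
    invariant (suc k)
      rewrite Σ<-last (suc k) (λ q → ⟦ S q ⟧) | Σ<-last k (λ p → ⟦ touches S p ⟧)
      with S (suc k) | S k | invariant k
    ... | false | b | ih rewrite ∨-identityʳ b = ih
    ... | true | b | ih rewrite ∨-zeroʳ b = s≤s (s≤s (grow-≤⇒≤ _ _ b ih))

  initial-touches : ∀ T r → (∀ p → T p ≡ true → p < r) → ∀ p → touches T p ≡ true → p < r
  initial-touches T r T<r p e with ∨-split e
  ... | inj₁ Tp = T<r p Tp
  ... | inj₂ Tp+1 = <-trans (n<1+n p) (T<r (suc p) Tp+1)

  <-grow : ∀ {p r} → p < r → p < grow r
  <-grow {r = suc r} p<r = m≤n⇒m≤1+n p<r

  suc-<-grow : ∀ {p r} → p < r → suc p < grow r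
  suc-<-grow {r = suc r} p<r = s≤s p<r

  inner-initial-touches : ∀ T r → T 0 ≡ false → (∀ q → T (suc q) ≡ true → q < r) →
                          ∀ p → touches T p ≡ true → p < grow r
  inner-initial-touches T r T0 T<r zero e with ∨-split e
  ... | inj₁ T0≡true with trans (sym T0) T0≡true
  ...   | ()
  inner-initial-touches T r T0 T<r zero e | inj₂ T1 = <-grow (T<r 0 T1)
  inner-initial-touches T r T0 T<r (suc p) e with ∨-split e
  ... | inj₁ Tp+1 = suc-<-grow (T<r p Tp+1)
  ... | inj₂ Tp+2 = <-grow (T<r (suc p) Tp+2)

  record Dominated (m : ℕ) (S T : ℕ → Bool) : Set where
    constructor dominated
    field
      κ : ℕ
      lower : m ⊓ κ ≤ nbhd S m
      upper : ∀ p → touches T p ≡ true → p < κ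

  longer-dominated : ∀ {S T m} r → r ≤ size S (suc m) → (∀ p → T p ≡ true → p < r) → Dominated m S T
  longer-dominated {S} {T} {m} r r≤ T<r =
    dominated r (≤-trans (⊓-monoʳ-≤ m r≤) (nbhd-longer S m)) (initial-touches T r T<r)

  shorter-dominated : ∀ {S T m} r → S 0 ≡ false → S m ≡ false → r ≤ size S (suc m) →
                      T 0 ≡ false → (∀ q → T (suc q) ≡ true → q < r) → Dominated m S T
  shorter-dominated {S} {T} {m} r S0 Sm r≤ T0 T<r =
    dominated (grow r) (≤-trans (m⊓n≤n m _) (≤-trans (grow-mono r≤) (nbhd-shorter S S0 m Sm)))
                       (inner-initial-touches T r T0 T<r)

  dominated-union : ∀ {m A B A' B'} → Dominated m A A' → Dominated m B B' →
                    Σ< m (λ p → ⟦ touches A' p ∨ touches B' p ⟧) ≤ Σ< m (λ p → ⟦ touches A p ∨ touches B p ⟧)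
  dominated-union {m} {A} {B} {A'} {B'} (dominated κA lowerA upperA) (dominated κB lowerB upperB) = begin
      Σ< m (λ p → ⟦ touches A' p ∨ touches B' p ⟧)
    ≤⟨ Σ<-mono m (λ p _ → ⟦⟧-mono (λ e → <ᵇ-true (below p e))) ⟩
      Σ< m (λ p → ⟦ p <ᵇ κA ⊔ κB ⟧)
    ≡⟨ Σ<-initial m (κA ⊔ κB) ⟩
      m ⊓ (κA ⊔ κB)
    ≡⟨ ⊓-distribˡ-⊔ m κA κB ⟩
      (m ⊓ κA) ⊔ (m ⊓ κB)
    ≤⟨ ⊔-lub (≤-trans lowerA (Σ<-mono m (λ p _ → ⟦⟧-mono (∨-inl _))))
             (≤-trans lowerB (Σ<-mono m (λ p _ → ⟦⟧-mono (∨-inr (touches A p))))) ⟩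
      Σ< m (λ p → ⟦ touches A p ∨ touches B p ⟧) ∎
    where
    open ≤-Reasoning
    below : ∀ p → (touches A' p ∨ touches B' p) ≡ true → p < κA ⊔ κB
    below p e with ∨-split e
    ... | inj₁ a = ≤-trans (upperA p a) (m≤m⊔n κA κB)
    ... | inj₂ b = ≤-trans (upperB p b) (m≤n⊔m κA κB)

-- The n × n grid with 0-based coordinates: a set of grid points is a
-- Boolean predicate X : ℕ → ℕ → Bool, usually supported on [0, n)².
-- Diagonal s consists of the points (s - b, b); position b is the
-- y-coordinate, so the order along a diagonal is the order of Defs.
module Grid (n : ℕ) where

  open import Data.Nat
  open import Data.Nat.Properties
  open import Data.Bool using (Bool; true; false; _∧_; _∨_; not; _xor_)
  open import Data.Bool.Properties using (∧-zeroʳ)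
  open import Data.Product using (_×_; _,_; proj₁; proj₂; Σ-syntax)
  open import Data.Sum using (inj₁; inj₂)
  open import Data.Empty using (⊥; ⊥-elim)
  open import Relation.Binary.PropositionalEquality
  open import Relation.Nullary using (yes; no; Dec)
  open BoolFacts
  open FiniteSums
  open PathNeighbourhood

  Plane : Set
  Plane = ℕ → ℕ → Bool

  Supported : Plane → Set
  Supported X = ∀ a b → X a b ≡ true → a < n × b < n

  odd : ℕ → Bool
  odd k = not (evenᵇ k)

  -- (s - b, b) is a grid point: b ≤ s and s - b < n
  onGrid : ℕ → ℕ → Bool
  onGrid s b = (b ≤ᵇ s) ∧ (s <ᵇ n + b)

  lo hi len : ℕ → ℕ
  lo s = (suc s ∸ n) ⊓ n
  hi s = suc s ⊓ n
  len s = hi s ∸ lo s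

  lo≤hi : ∀ s → lo s ≤ hi s
  lo≤hi s = ⊓-monoˡ-≤ n (m∸n≤m (suc s) n)

  private
    ⊓-low : ∀ {x m b} → x ⊓ m ≤ b → b < m → x ≤ b
    ⊓-low {x} {m} {b} h b<m with ≤-total x m
    ... | inj₁ x≤m = subst (_≤ b) (m≤n⇒m⊓n≡m x≤m) h
    ... | inj₂ m≤x = ⊥-elim (<⇒≱ b<m (subst (_≤ b) (m≥n⇒m⊓n≡n m≤x) h))

  onGrid-window : ∀ s b → b < n → onGrid s b ≡ ((lo s ≤ᵇ b) ∧ (b <ᵇ hi s))
  onGrid-window s b b<n = bool-≡ to from
    where
    to : onGrid s b ≡ true → ((lo s ≤ᵇ b) ∧ (b <ᵇ hi s)) ≡ true
    to e with ∧-split e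
    ... | b≤s , s<n+b =
      ∧-intro (≤ᵇ-true (≤-trans (m⊓n≤m _ n) (m≤n+o⇒m∸n≤o (suc s) n (<ᵇ-sound s (n + b) s<n+b))))
              (<ᵇ-true (⊓-glb (s≤s (≤ᵇ-sound b s b≤s)) b<n))
    from : ((lo s ≤ᵇ b) ∧ (b <ᵇ hi s)) ≡ true → onGrid s b ≡ true
    from e with ∧-split e
    ... | lo≤b , b<hi =
      ∧-intro (≤ᵇ-true (≤-pred (≤-trans (<ᵇ-sound b (hi s) b<hi) (m⊓n≤m (suc s) n))))
              (<ᵇ-true (≤-trans (m≤n+m∸n (suc s) n) (+-monoʳ-≤ n (⊓-low (≤ᵇ-sound (lo s) b lo≤b) b<n))))

  onGrid-intro : ∀ s j → j ≤ s → s ∸ j < n → onGrid s j ≡ true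
  onGrid-intro s j j≤s h = ∧-intro (≤ᵇ-true j≤s) (<ᵇ-true (subst (_< n + j) (m∸n+n≡m j≤s) (+-monoˡ-< j h)))

  lower-diagonal : ∀ s → s < n → lo s ≡ 0 × len s ≡ suc s
  lower-diagonal s s<n = lo≡0 , cong₂ _∸_ (m≤n⇒m⊓n≡m s<n) lo≡0
    where
    lo≡0 : lo s ≡ 0
    lo≡0 = cong (_⊓ n) (m≤n⇒m∸n≡0 s<n)

  upper-diagonal : ∀ u → u < n → lo (n + u) ≡ suc u × len (n + u) ≡ n ∸ suc u
  upper-diagonal u u<n = lo≡ , cong₂ _∸_ (m≥n⇒m⊓n≡n (≤-trans (m≤m+n n u) (n≤1+n _))) lo≡
    where
    lo≡ : lo (n + u) ≡ suc u
    lo≡ = trans (cong (_⊓ n) (trans (cong (_∸ n) (sym (+-suc n u))) (m+n∸m≡n n (suc u))))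
                (m≤n⇒m⊓n≡m u<n)

  Σ<-diagonal : ∀ s (Z : ℕ → Bool) → Σ< n (λ b → ⟦ onGrid s b ∧ Z b ⟧) ≡ Σ< (len s) (λ p → ⟦ Z (lo s + p) ⟧)
  Σ<-diagonal s Z = trans (Σ<-cong n (λ b b<n → cong (λ z → ⟦ z ∧ Z b ⟧) (onGrid-window s b b<n)))
                          (Σ<-window n (lo s) (hi s) Z (lo≤hi s) (m⊓n≤n _ n))

  Σ²-diagonal : ∀ s (Z : Plane) → Σ< n (λ i → Σ< n (λ j → ⟦ (i + j ≡ᵇ s) ∧ Z i j ⟧))
                                  ≡ Σ< n (λ j → ⟦ onGrid s j ∧ Z (s ∸ j) j ⟧)
  Σ²-diagonal s Z = trans (Σ<-swap n n _) (Σ<-cong n (λ j _ → column j))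
    where
    column : ∀ j → Σ< n (λ i → ⟦ (i + j ≡ᵇ s) ∧ Z i j ⟧) ≡ ⟦ onGrid s j ∧ Z (s ∸ j) j ⟧
    column j with j ≤? s
    ... | yes j≤s = trans (Σ<-cong n (λ i _ → cong (λ z → ⟦ z ∧ Z i j ⟧) (solve-i i)))
                          (trans (Σ<-point n (s ∸ j) (λ i → Z i j)) (cong (λ z → ⟦ z ∧ Z (s ∸ j) j ⟧) in-grid))
      where
      solve-i : ∀ i → (i + j ≡ᵇ s) ≡ (i ≡ᵇ s ∸ j)
      solve-i i = bool-≡ (λ e → ≡ᵇ-true (sym (trans (cong (_∸ j) (sym (≡ᵇ-sound (i + j) s e))) (m+n∸n≡m i j))))
                         (λ e → ≡ᵇ-true (trans (cong (_+ j) (≡ᵇ-sound i (s ∸ j) e)) (m∸n+n≡m j≤s)))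
      in-grid : (s ∸ j <ᵇ n) ≡ onGrid s j
      in-grid rewrite ≤ᵇ-true j≤s = bool-≡
        (λ e → <ᵇ-true (subst (_< n + j) (m∸n+n≡m j≤s) (+-monoˡ-< j (<ᵇ-sound _ _ e))))
        (λ e → <ᵇ-true (+-cancelʳ-< j (s ∸ j) n (subst (_< n + j) (sym (m∸n+n≡m j≤s)) (<ᵇ-sound _ _ e))))
    ... | no j≰s =
      trans (Σ<-zero n (λ i _ → cong (λ z → ⟦ z ∧ Z i j ⟧) (≡ᵇ-false (λ e → j≰s (subst (j ≤_) e (m≤n+m j i))))))
            (cong (λ z → ⟦ (z ∧ (s <ᵇ n + j)) ∧ Z (s ∸ j) j ⟧) (sym (≤ᵇ-false j≰s)))

  Σ²-by-diagonals : ∀ (Y : Plane) → Σ< n (λ a → Σ< n (λ b → ⟦ Y a b ⟧))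
                                    ≡ Σ< (n + n) (λ t → Σ< n (λ b → ⟦ onGrid t b ∧ Y (t ∸ b) b ⟧))
  Σ²-by-diagonals Y =
    trans (Σ<-swap n n _) (trans (Σ<-cong n (λ b b<n → sym (column b b<n))) (sym (Σ<-swap (n + n) n _)))
    where
    column : ∀ b → b < n → Σ< (n + n) (λ t → ⟦ onGrid t b ∧ Y (t ∸ b) b ⟧) ≡ Σ< n (λ a → ⟦ Y a b ⟧)
    column b b<n = begin
        Σ< (n + n) G
      ≡⟨ Σ<-split≤ b (n + n) G (≤-trans (<⇒≤ b<n) (m≤m+n n n)) ⟩
        Σ< b G + Σ< (n + n ∸ b) (λ a → G (b + a))
      ≡⟨ cong₂ _+_ (Σ<-zero b (λ t t<b → cong (λ z → ⟦ (z ∧ (t <ᵇ n + b)) ∧ Y (t ∸ b) b ⟧) (≤ᵇ-false (<⇒≱ t<b))))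
                   (Σ<-cong (n + n ∸ b) (λ a _ → cong₂ (λ u v → ⟦ u ∧ Y v b ⟧) (onGrid-column a) (m+n∸m≡n b a))) ⟩
        Σ< (n + n ∸ b) (λ a → ⟦ (a <ᵇ n) ∧ Y a b ⟧)
      ≡⟨ Σ<-split≤ n (n + n ∸ b) _ n≤ ⟩
        Σ< n (λ a → ⟦ (a <ᵇ n) ∧ Y a b ⟧) + Σ< (n + n ∸ b ∸ n) (λ q → ⟦ (n + q <ᵇ n) ∧ Y (n + q) b ⟧)
      ≡⟨ cong₂ _+_ (Σ<-cong n (λ a a<n → cong (λ z → ⟦ z ∧ Y a b ⟧) (<ᵇ-true a<n)))
                   (Σ<-zero (n + n ∸ b ∸ n) (λ q _ → cong (λ z → ⟦ z ∧ Y (n + q) b ⟧)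
                                                          (<ᵇ-false (λ h → <⇒≱ h (m≤m+n n q))))) ⟩
        Σ< n (λ a → ⟦ Y a b ⟧) + 0
      ≡⟨ +-identityʳ _ ⟩
        Σ< n (λ a → ⟦ Y a b ⟧) ∎
      where
      open ≡-Reasoning
      G : ℕ → ℕ
      G t = ⟦ onGrid t b ∧ Y (t ∸ b) b ⟧
      n≤ : n ≤ n + n ∸ b
      n≤ = subst (_≤ n + n ∸ b) (m+n∸n≡m n n) (∸-monoʳ-≤ (n + n) (<⇒≤ b<n))
      onGrid-column : ∀ a → onGrid (b + a) b ≡ (a <ᵇ n)
      onGrid-column a =
        bool-≡ (λ e → <ᵇ-true (+-cancelˡ-< b a n (subst (b + a <_) (+-comm n b) (<ᵇ-sound _ _ (proj₂ (∧-split e))))))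
               (λ e → ∧-intro (≤ᵇ-true (m≤m+n b a)) (<ᵇ-true (subst (b + a <_) (+-comm b n) (+-monoʳ-< b (<ᵇ-sound _ _ e)))))

  below left : Plane → Plane
  below X a zero = false
  below X a (suc b) = X a b
  left X zero b = false
  left X (suc a) b = X a b

  hasNeighbour : Plane → Plane
  hasNeighbour X a b = (below X a b ∨ left X a b) ∨ (X (suc a) b ∨ X a (suc b))

  -- number of grid points of parity class d (odd points for d = false)
  -- having a neighbour in X; for X ⊆ V₁ and d = false this is δ(X)
  boundary : Bool → Plane → ℕ
  boundary d X = Σ< n (λ a → Σ< n (λ b → ⟦ (odd (a + b) xor d) ∧ hasNeighbour X a b ⟧))

  diag : Plane → ℕ → ℕ → Bool
  diag X s j = (j ≤ᵇ s) ∧ X (s ∸ j) j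

  -- diagonal t - 1 seen from diagonal t: position b of t is adjacent to
  -- positions b - 1 and b of diagonal t - 1, and b, b + 1 of diagonal t + 1
  prevDiag : Plane → ℕ → ℕ → Bool
  prevDiag X zero q = false
  prevDiag X (suc t) zero = false
  prevDiag X (suc t) (suc q) = diag X t q

  neighbourOnDiag : Plane → ℕ → ℕ → Bool
  neighbourOnDiag X t b = (prevDiag X t b ∨ prevDiag X t (suc b)) ∨ (diag X (suc t) b ∨ diag X (suc t) (suc b))

  hasNeighbour-diag : ∀ X t b → b ≤ t → hasNeighbour X (t ∸ b) b ≡ neighbourOnDiag X t b
  hasNeighbour-diag X t b b≤t =
    cong₂ _∨_ (cong₂ _∨_ (below-diag t b b≤t) (left-diag t b b≤t)) (cong₂ _∨_ right-diag above-diag)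
    where
    below-diag : ∀ t b → b ≤ t → below X (t ∸ b) b ≡ prevDiag X t b
    below-diag zero zero _ = refl
    below-diag (suc t) zero _ = refl
    below-diag (suc t) (suc b) (s≤s b≤t) rewrite ≤ᵇ-true b≤t = refl
    left-diag : ∀ t b → b ≤ t → left X (t ∸ b) b ≡ prevDiag X t (suc b)
    left-diag zero zero _ = refl
    left-diag (suc t) b b≤t+1 with b ≤? t
    ... | yes b≤t rewrite +-∸-assoc 1 b≤t | ≤ᵇ-true b≤t = refl
    ... | no b≰t rewrite ≤ᵇ-false b≰t | ≤-antisym b≤t+1 (≰⇒> b≰t) | n∸n≡0 (suc t) = refl
    right-diag : X (suc (t ∸ b)) b ≡ diag X (suc t) b
    right-diag rewrite ≤ᵇ-true (≤-trans b≤t (n≤1+n t)) | +-∸-assoc 1 b≤t = refl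
    above-diag : X (t ∸ b) (suc b) ≡ diag X (suc t) (suc b)
    above-diag rewrite ≤ᵇ-true (s≤s b≤t) = refl

  boundary-by-diagonals : ∀ d Y → boundary d Y
                          ≡ Σ< (n + n) (λ t → Σ< n (λ b → ⟦ (odd t xor d) ∧ (onGrid t b ∧ neighbourOnDiag Y t b) ⟧))
  boundary-by-diagonals d Y =
    trans (Σ²-by-diagonals (λ a b → (odd (a + b) xor d) ∧ hasNeighbour Y a b))
          (Σ<-cong (n + n) (λ t _ → Σ<-cong n (λ b _ → cong ⟦_⟧ (pointwise t b))))
    where
    pointwise : ∀ t b → (onGrid t b ∧ ((odd (t ∸ b + b) xor d) ∧ hasNeighbour Y (t ∸ b) b))
                        ≡ ((odd t xor d) ∧ (onGrid t b ∧ neighbourOnDiag Y t b))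
    pointwise t b with onGrid t b in e
    ... | false = sym (∧-zeroʳ _)
    ... | true rewrite m∸n+n≡m (≤ᵇ-sound b t (proj₁ (∧-split e)))
                     | hasNeighbour-diag Y t b (≤ᵇ-sound b t (proj₁ (∧-split e))) = refl

  diagSize : Plane → ℕ → ℕ
  diagSize X s = Σ< n (λ i → Σ< n (λ j → ⟦ (i + j ≡ᵇ s) ∧ X i j ⟧))

  rank : ℕ → ℕ → ℕ
  rank s b = Σ< n (λ i → Σ< n (λ j → ⟦ (i + j ≡ᵇ s) ∧ (j <ᵇ b) ⟧))

  -- Shifting: on diagonals of the class opposite to d, X is replaced by the
  -- first diagSize X s grid points of each diagonal s; the class d is emptied.
  shiftDiag : Bool → Plane → Plane
  shiftDiag d X a b = (a <ᵇ n) ∧ ((b <ᵇ n) ∧ (not (odd (a + b) xor d) ∧ (rank (a + b) b <ᵇ diagSize X (a + b))))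

  shiftDiag-supported : ∀ d X → Supported (shiftDiag d X)
  shiftDiag-supported d X a b e =
    <ᵇ-sound a n (proj₁ (∧-split {a <ᵇ n} e)) , <ᵇ-sound b n (proj₁ (∧-split {b <ᵇ n} (proj₂ (∧-split {a <ᵇ n} e))))

  diagSize-positions : ∀ X s → diagSize X s ≡ Σ< (len s) (λ p → ⟦ diag X s (lo s + p) ⟧)
  diagSize-positions X s =
    trans (Σ²-diagonal s X)
          (trans (Σ<-cong n (λ j _ → cong ⟦_⟧ (guard (j ≤ᵇ s) (s <ᵇ n + j) (X (s ∸ j) j))))
                 (Σ<-diagonal s (diag X s)))
    where
    guard : ∀ a b c → ((a ∧ b) ∧ c) ≡ ((a ∧ b) ∧ (a ∧ c))
    guard true b c = refl
    guard false b c = refl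

  rank-position : ∀ s q → q ≤ len s → rank s (lo s + q) ≡ q
  rank-position s q q≤ =
    trans (Σ²-diagonal s _)
    (trans (Σ<-diagonal s (λ j → j <ᵇ lo s + q))
    (trans (Σ<-cong (len s) (λ p _ → cong ⟦_⟧ (bool-≡
              (λ e → <ᵇ-true (+-cancelˡ-< (lo s) p q (<ᵇ-sound _ _ e)))
              (λ e → <ᵇ-true (+-monoʳ-< (lo s) (<ᵇ-sound _ _ e))))))
    (trans (Σ<-initial (len s) q) (m≥n⇒m⊓n≡n q≤))))

  shiftDiag-initial : ∀ d X s j → diag (shiftDiag d X) s j ≡ true → Σ[ q ∈ ℕ ] (j ≡ lo s + q × q < diagSize X s)
  shiftDiag-initial d X s j e = j ∸ lo s , sym (m+[n∸m]≡n {lo s} lo≤j) , q<r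
    where
    e₁ = ∧-split e
    j≤s = ≤ᵇ-sound j s (proj₁ e₁)
    e₂ = ∧-split (proj₂ e₁)
    e₃ = ∧-split (proj₂ e₂)
    e₄ = ∧-split (proj₂ e₃)
    window = ∧-split (trans (sym (onGrid-window s j (<ᵇ-sound _ _ (proj₁ e₃))))
                            (onGrid-intro s j j≤s (<ᵇ-sound _ _ (proj₁ e₂))))
    lo≤j = ≤ᵇ-sound _ _ (proj₁ window)
    q≤ : j ∸ lo s ≤ len s
    q≤ = ∸-monoˡ-≤ (lo s) (<⇒≤ (<ᵇ-sound _ _ (proj₂ window)))
    q<r : j ∸ lo s < diagSize X s
    q<r = subst₂ _<_ (trans (cong (λ z → rank z j) (m∸n+n≡m j≤s))
                            (trans (cong (rank s) (sym (m+[n∸m]≡n {lo s} lo≤j))) (rank-position s (j ∸ lo s) q≤)))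
                     (cong (diagSize X) (m∸n+n≡m j≤s)) (<ᵇ-sound _ _ (proj₂ e₄))

  diag-window : ∀ X → Supported X → ∀ s j → diag X s j ≡ true → lo s ≤ j × j < hi s
  diag-window X supp s j e = ≤ᵇ-sound _ _ (proj₁ window) , <ᵇ-sound _ _ (proj₂ window)
    where
    e₁ = ∧-split e
    in-grid = supp _ _ (proj₂ e₁)
    window = ∧-split (trans (sym (onGrid-window s j (proj₂ in-grid)))
                            (onGrid-intro s j (≤ᵇ-sound j s (proj₁ e₁)) (proj₁ in-grid)))

  -- Position p of the window of t (point lo t + p) is adjacent to positions
  -- p and p + 1 of the sequences prevSide and nextSide read off the
  -- diagonals t - 1 and t + 1.
  module Line (d : Bool) (X : Plane) (supp : Supported X) where

    X' : Plane
    X' = shiftDiag d X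

    prevSide nextSide : Plane → ℕ → ℕ → ℕ → Bool
    prevSide Y t L p = prevDiag Y t (L + p)
    nextSide Y t L p = diag Y (suc t) (L + p)

    lineNeighbour : Plane → ℕ → ℕ → ℕ → Bool
    lineNeighbour Y t L p = touches (prevSide Y t L) p ∨ touches (nextSide Y t L) p

    line-neighbours : ∀ Y t → Σ< n (λ b → ⟦ onGrid t b ∧ neighbourOnDiag Y t b ⟧)
                              ≡ Σ< (len t) (λ p → ⟦ lineNeighbour Y t (lo t) p ⟧)
    line-neighbours Y t = trans (Σ<-diagonal t (neighbourOnDiag Y t))
                                (Σ<-cong (len t) (λ p _ → cong ⟦_⟧ (shifted p)))
      where
      shifted : ∀ p → neighbourOnDiag Y t (lo t + p) ≡ lineNeighbour Y t (lo t) p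
      shifted p rewrite +-suc (lo t) p = refl

    shifted-below : ∀ s L → lo s ≡ L → ∀ p → diag X' s (L + p) ≡ true → p < diagSize X s
    shifted-below s L lo≡L p e with shiftDiag-initial d X s (L + p) e
    ... | q , L+p≡ , q<r = subst (_< diagSize X s) (sym (+-cancelˡ-≡ L p q (trans L+p≡ (cong (_+ q) lo≡L)))) q<r

    shifted-before-window : ∀ s L → lo s ≡ suc L → diag X' s L ≡ false
    shifted-before-window s L lo≡ = not-true (λ e → outside (shiftDiag-initial d X s L e))
      where
      outside : Σ[ q ∈ ℕ ] (L ≡ lo s + q × q < diagSize X s) → ⊥
      outside (q , L≡ , _) = <⇒≱ (s≤s (m≤m+n L q)) (≤-reflexive (sym (trans L≡ (cong (_+ q) lo≡))))

    before-window : ∀ s j → j < lo s → diag X s j ≡ false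
    before-window s j j< = not-true (λ e → <⇒≱ j< (proj₁ (diag-window X supp s j e)))

    after-window : ∀ s j → hi s ≤ j → diag X s j ≡ false
    after-window s j h = not-true (λ e → <⇒≱ (proj₂ (diag-window X supp s j e)) h)

    -- Lower half (t < n): diagonal t - 1 is one shorter than t.
    prev-dominated-lower : ∀ t → t < n → Dominated (suc t) (prevSide X t 0) (prevSide X' t 0)
    prev-dominated-lower zero _ = dominated 0 z≤n (λ p ())
    prev-dominated-lower (suc t) t+1<n = shorter-dominated (diagSize X t) refl last-empty r≤ refl (shifted-below t 0 lo≡0)
      where
      t<n : t < n
      t<n = <-trans (n<1+n t) t+1<n
      lo≡0 = proj₁ (lower-diagonal t t<n)
      last-empty : prevSide X (suc t) 0 (suc (suc t)) ≡ false
      last-empty rewrite ≤ᵇ-false {suc t} {t} 1+n≰n = refl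
      r≤ : diagSize X t ≤ size (prevSide X (suc t) 0) (suc (suc (suc t)))
      r≤ rewrite diagSize-positions X t | proj₂ (lower-diagonal t t<n) | lo≡0 =
        Σ<-length-mono {suc t} {suc (suc t)} (λ p → ⟦ diag X t p ⟧) (n≤1+n _)

    -- Lower half, t + 1 < n: diagonal t + 1 is one longer than t.
    next-dominated-lower : ∀ t → suc t < n → Dominated (suc t) (nextSide X t 0) (nextSide X' t 0)
    next-dominated-lower t t+1<n = longer-dominated (diagSize X (suc t)) r≤ (shifted-below (suc t) 0 lo≡0)
      where
      lo≡0 = proj₁ (lower-diagonal (suc t) t+1<n)
      r≤ : diagSize X (suc t) ≤ size (nextSide X t 0) (suc (suc t))
      r≤ rewrite diagSize-positions X (suc t) | proj₂ (lower-diagonal (suc t) t+1<n) | lo≡0 = ≤-refl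

    -- The middle diagonal t = n - 1: diagonal t + 1 is one shorter.
    next-dominated-middle : ∀ t → n ≡ suc t → Dominated (suc t) (nextSide X t 0) (nextSide X' t 0)
    next-dominated-middle t n≡ =
      shorter-dominated r first-empty last-empty r≤ (shifted-before-window (suc t) 0 lo≡1) (shifted-below (suc t) 1 lo≡1)
      where
      r = diagSize X (suc t)
      0<n : 0 < n
      0<n = subst (0 <_) (sym n≡) z<s
      n+0≡ : n + 0 ≡ suc t
      n+0≡ = trans (+-identityʳ n) n≡
      lo≡1 : lo (suc t) ≡ 1
      lo≡1 = trans (cong lo (sym n+0≡)) (proj₁ (upper-diagonal 0 0<n))
      len≡ : len (suc t) ≡ t
      len≡ = trans (cong len (sym n+0≡)) (trans (proj₂ (upper-diagonal 0 0<n)) (cong (_∸ 1) n≡))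
      first-empty : nextSide X t 0 0 ≡ false
      first-empty = before-window (suc t) 0 (subst (0 <_) (sym lo≡1) z<s)
      last-empty : nextSide X t 0 (suc t) ≡ false
      last-empty = after-window (suc t) (suc t) (subst (hi (suc t) ≤_) n≡ (m⊓n≤n _ n))
      r≤ : r ≤ size (nextSide X t 0) (suc (suc t))
      r≤ rewrite diagSize-positions X (suc t) | len≡ | lo≡1 =
        ≤-trans (Σ<-length-mono (λ p → ⟦ diag X (suc t) (suc p) ⟧) (n≤1+n t)) (m≤n+m _ ⟦ diag X (suc t) 0 ⟧)

    upper-window : ∀ t' u → suc t' ≡ n + u → u < n → lo t' ≡ u × len t' ≡ n ∸ u
    upper-window t' zero eq u<n = proj₁ (lower-diagonal t' t'<n) , trans (proj₂ (lower-diagonal t' t'<n)) (trans eq (+-identityʳ n))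
      where
      t'<n : t' < n
      t'<n = ≤-reflexive (trans eq (+-identityʳ n))
    upper-window t' (suc u) eq u<n =
      trans (cong lo t'≡) (proj₁ (upper-diagonal u u<n')) , trans (cong len t'≡) (proj₂ (upper-diagonal u u<n'))
      where
      u<n' : u < n
      u<n' = <-trans (n<1+n u) u<n
      t'≡ : t' ≡ n + u
      t'≡ = suc-injective (trans eq (+-suc n u))

    -- Upper half, t = t' + 1 = n + u: diagonal t - 1 is one longer than t.
    prev-dominated-upper : ∀ t' u → suc t' ≡ n + u → suc u < n →
                           Dominated (n ∸ suc u) (prevSide X (suc t') (suc u)) (prevSide X' (suc t') (suc u))
    prev-dominated-upper t' u eq u+1<n = longer-dominated (diagSize X t') r≤ (shifted-below t' u (proj₁ window))
      where
      window = upper-window t' u eq (<-trans (n<1+n u) u+1<n)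
      r≤ : diagSize X t' ≤ size (prevSide X (suc t') (suc u)) (suc (n ∸ suc u))
      r≤ rewrite diagSize-positions X t' | proj₂ window | proj₁ window =
        Σ<-length-mono (λ p → ⟦ diag X t' (u + p) ⟧) (≤-reflexive (+-∸-assoc 1 {n} {suc u} (<⇒≤ u+1<n)))

    -- Upper half: diagonal t + 1 is one shorter than t.
    next-dominated-upper : ∀ t' u → suc t' ≡ n + u → suc u < n →
                           Dominated (n ∸ suc u) (nextSide X (suc t') (suc u)) (nextSide X' (suc t') (suc u))
    next-dominated-upper t' u eq u+1<n =
      shorter-dominated r first-empty last-empty r≤ shifted-first-empty shifted-rest
      where
      s = suc (suc t')
      m = n ∸ suc u
      s≡ : n + suc u ≡ s
      s≡ = trans (+-suc n u) (cong suc (sym eq))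
      lo≡ : lo s ≡ suc (suc u)
      lo≡ = trans (cong lo (sym s≡)) (proj₁ (upper-diagonal (suc u) u+1<n))
      len≡ : len s ≡ n ∸ suc (suc u)
      len≡ = trans (cong len (sym s≡)) (proj₂ (upper-diagonal (suc u) u+1<n))
      r = diagSize X s
      first-empty : nextSide X (suc t') (suc u) 0 ≡ false
      first-empty = before-window s (suc u + 0) (subst (_< lo s) (sym (+-identityʳ (suc u))) (subst (suc u <_) (sym lo≡) ≤-refl))
      last-empty : nextSide X (suc t') (suc u) m ≡ false
      last-empty = after-window s (suc u + m) (subst (hi s ≤_) (sym (m+[n∸m]≡n {suc u} (<⇒≤ u+1<n))) (m⊓n≤n _ n))
      r≤ : r ≤ size (nextSide X (suc t') (suc u)) (suc m)
      r≤ rewrite diagSize-positions X s | len≡ | lo≡ =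
        ≤-trans (Σ<-length-mono (λ p → ⟦ diag X s (suc (suc u) + p) ⟧) (∸-monoʳ-≤ n (n≤1+n (suc u))))
                (≤-trans (≤-reflexive (Σ<-cong m (λ k _ → cong (λ z → ⟦ diag X s z ⟧) (sym (+-suc (suc u) k)))))
                         (m≤n+m _ _))
      shifted-first-empty : nextSide X' (suc t') (suc u) 0 ≡ false
      shifted-first-empty = shifted-before-window s (suc u + 0) (trans lo≡ (cong suc (sym (+-identityʳ (suc u)))))
      shifted-rest : ∀ q → nextSide X' (suc t') (suc u) (suc q) ≡ true → q < r
      shifted-rest q e = shifted-below s (suc (suc u)) lo≡ q (subst (λ z → diag X' s z ≡ true) (+-suc (suc u) q) e)

    LineComparison : ℕ → Set
    LineComparison t = Σ< (len t) (λ p → ⟦ lineNeighbour X' t (lo t) p ⟧) ≤ Σ< (len t) (λ p → ⟦ lineNeighbour X t (lo t) p ⟧)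

    line-upper : ∀ t → n ≤ t → t < n + n → LineComparison t
    line-upper zero z≤n _ = z≤n
    line-upper (suc t') n≤t t< = on-window (suc t' ∸ n) t≡ u<n
      where
      t≡ : suc t' ≡ n + (suc t' ∸ n)
      t≡ = sym (m+[n∸m]≡n n≤t)
      u<n : suc t' ∸ n < n
      u<n = +-cancelˡ-< n (suc t' ∸ n) n (subst (_< n + n) t≡ t<)
      on-window : ∀ u → suc t' ≡ n + u → u < n → LineComparison (suc t')
      on-window u eq u<n with suc u <? n
      ... | yes u+1<n rewrite trans (cong len eq) (proj₂ (upper-diagonal u u<n))
                            | trans (cong lo eq) (proj₁ (upper-diagonal u u<n)) =
            dominated-union (prev-dominated-upper t' u eq u+1<n) (next-dominated-upper t' u eq u+1<n)
      ... | no u+1≮n rewrite trans (cong len eq) (trans (proj₂ (upper-diagonal u u<n)) (m≤n⇒m∸n≡0 (≮⇒≥ u+1≮n))) = z≤n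

    line-comparison : ∀ t → t < n + n → LineComparison t
    line-comparison t t< with t <? n
    ... | yes t<n rewrite proj₂ (lower-diagonal t t<n) | proj₁ (lower-diagonal t t<n) =
          dominated-union (prev-dominated-lower t t<n) (next-side (suc t <? n))
      where
      next-side : Dec (suc t < n) → Dominated (suc t) (nextSide X t 0) (nextSide X' t 0)
      next-side (yes t+1<n) = next-dominated-lower t t+1<n
      next-side (no t+1≮n) = next-dominated-middle t (≤-antisym (≮⇒≥ t+1≮n) t<n)
    ... | no t≮n = line-upper t (≮⇒≥ t≮n) t<

  shiftDiag-boundary : ∀ d X → Supported X → boundary d (shiftDiag d X) ≤ boundary d X
  shiftDiag-boundary d X supp rewrite boundary-by-diagonals d (shiftDiag d X) | boundary-by-diagonals d X =
    Σ<-mono (n + n) on-diagonal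
    where
    open Line d X supp
    on-diagonal : ∀ t → t < n + n → Σ< n (λ b → ⟦ (odd t xor d) ∧ (onGrid t b ∧ neighbourOnDiag X' t b) ⟧)
                                  ≤ Σ< n (λ b → ⟦ (odd t xor d) ∧ (onGrid t b ∧ neighbourOnDiag X t b) ⟧)
    on-diagonal t t< with odd t xor d
    ... | false = ≤-reflexive (trans (Σ<-zero n (λ _ _ → refl)) (sym (Σ<-zero n (λ _ _ → refl))))
    ... | true rewrite line-neighbours X' t | line-neighbours X t = line-comparison t t<

module ListCounting where

  open import Data.Nat
  open import Data.Nat.Properties using (+-assoc)
  open import Data.Bool using (Bool; true; false)
  open import Data.Fin using (Fin; toℕ)
  open import Data.List using (List; []; _∷_; _++_; map; concatMap; tabulate; allFin)
  open import Data.Product using (_,_)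
  open import Relation.Binary.PropositionalEquality
  open FiniteSums

  countᵇ-∷ : ∀ {A : Set} (p : A → Bool) x xs → countᵇ p (x ∷ xs) ≡ ⟦ p x ⟧ + countᵇ p xs
  countᵇ-∷ p x xs with p x
  ... | true = refl
  ... | false = refl

  countᵇ-++ : ∀ {A : Set} (p : A → Bool) xs ys → countᵇ p (xs ++ ys) ≡ countᵇ p xs + countᵇ p ys
  countᵇ-++ p [] ys = refl
  countᵇ-++ p (x ∷ xs) ys = begin
      countᵇ p (x ∷ xs ++ ys)                 ≡⟨ countᵇ-∷ p x (xs ++ ys) ⟩
      ⟦ p x ⟧ + countᵇ p (xs ++ ys)           ≡⟨ cong (⟦ p x ⟧ +_) (countᵇ-++ p xs ys) ⟩
      ⟦ p x ⟧ + (countᵇ p xs + countᵇ p ys)   ≡⟨ sym (+-assoc ⟦ p x ⟧ _ _) ⟩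
      ⟦ p x ⟧ + countᵇ p xs + countᵇ p ys     ≡⟨ cong (_+ countᵇ p ys) (sym (countᵇ-∷ p x xs)) ⟩
      countᵇ p (x ∷ xs) + countᵇ p ys         ∎
    where open ≡-Reasoning

  countᵇ-map : ∀ {A B : Set} (p : B → Bool) (f : A → B) xs → countᵇ p (map f xs) ≡ countᵇ (λ x → p (f x)) xs
  countᵇ-map p f [] = refl
  countᵇ-map p f (x ∷ xs) =
    trans (countᵇ-∷ p (f x) (map f xs)) (trans (cong (⟦ p (f x) ⟧ +_) (countᵇ-map p f xs)) (sym (countᵇ-∷ _ x xs)))

  countᵇ-tabulate : ∀ {A : Set} k (f : Fin k → A) (p : A → Bool) (h : ℕ → Bool) → (∀ a → p (f a) ≡ h (toℕ a)) →
                    countᵇ p (tabulate f) ≡ Σ< k (λ i → ⟦ h i ⟧)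
  countᵇ-tabulate zero f p h e = refl
  countᵇ-tabulate (suc k) f p h e =
    trans (countᵇ-∷ p (f Fin.zero) (tabulate (λ x → f (Fin.suc x))))
          (cong₂ _+_ (cong ⟦_⟧ (e Fin.zero)) (countᵇ-tabulate k (λ x → f (Fin.suc x)) p (λ i → h (suc i)) (λ a → e (Fin.suc a))))

  countᵇ-concatMap : ∀ {A B : Set} k (f : Fin k → A) (g : A → List B) (p : B → Bool) (H : ℕ → ℕ) →
                     (∀ a → countᵇ p (g (f a)) ≡ H (toℕ a)) → countᵇ p (concatMap g (tabulate f)) ≡ Σ< k H
  countᵇ-concatMap zero f g p H e = refl
  countᵇ-concatMap (suc k) f g p H e =
    trans (countᵇ-++ p (g (f Fin.zero)) _)
          (cong₂ _+_ (e Fin.zero) (countᵇ-concatMap k (λ x → f (Fin.suc x)) g p (λ i → H (suc i)) (λ a → e (Fin.suc a))))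

  count-vertices : ∀ n (f : Vertex n → Bool) (g : ℕ → ℕ → Bool) → (∀ i j → f (i , j) ≡ g (toℕ i) (toℕ j)) →
                   countᵇ f (vertices n) ≡ Σ< n (λ a → Σ< n (λ b → ⟦ g a b ⟧))
  count-vertices n f g e =
    countᵇ-concatMap n (λ x → x) _ f _
      (λ i → trans (countᵇ-map f _ (allFin n)) (countᵇ-tabulate n (λ x → x) (λ j → f (i , j)) (g (toℕ i)) (λ j → e i j)))

  anyᵇ-countᵇ : ∀ {A : Set} (p : A → Bool) xs → anyᵇ p xs ≡ (0 <ᵇ countᵇ p xs)
  anyᵇ-countᵇ p [] = refl
  anyᵇ-countᵇ p (x ∷ xs) with p x
  ... | true = refl
  ... | false = anyᵇ-countᵇ p xs

module VertexSets (n : ℕ) where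

  open import Data.Nat
  open import Data.Nat.Properties
  open import Data.Bool using (Bool; true; false; _∧_; _∨_; not; _xor_)
  open import Data.Bool.Properties
    using (∨-commutativeMonoid; not-involutive; not-distribˡ-xor; xor-identityʳ; xor-assoc; xor-comm; xor-same)
  open import Data.Product using (_×_; _,_; proj₁; proj₂; Σ-syntax)
  open import Data.Sum using (_⊎_; inj₁; inj₂)
  open import Data.Empty using (⊥; ⊥-elim)
  open import Data.Fin using (Fin; toℕ; fromℕ<)
  open import Data.Fin.Properties using (toℕ-fromℕ<; fromℕ<-toℕ; toℕ<n)
  open import Algebra.Bundles using (CommutativeMonoid)
  open import Algebra.Properties.CommutativeSemigroup (CommutativeMonoid.commutativeSemigroup ∨-commutativeMonoid)
    using () renaming (interchange to ∨-interchange)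
  open import Relation.Binary.PropositionalEquality
  open import Relation.Nullary using (yes; no)
  open BoolFacts
  open FiniteSums
  open ListCounting
  open Grid n

  embed : VSet n → Plane
  embed S a b with a <? n | b <? n
  ... | yes a<n | yes b<n = S (fromℕ< a<n , fromℕ< b<n)
  ... | yes _ | no _ = false
  ... | no _ | _ = false

  embed-toℕ : ∀ (S : VSet n) i j → embed S (toℕ i) (toℕ j) ≡ S (i , j)
  embed-toℕ S i j with toℕ i <? n | toℕ j <? n
  ... | yes p | yes q = cong₂ (λ x y → S (x , y)) (fromℕ<-toℕ i p) (fromℕ<-toℕ j q)
  ... | yes p | no q = ⊥-elim (q (toℕ<n j))
  ... | no p | _ = ⊥-elim (p (toℕ<n i))

  embed-point : ∀ (S : VSet n) a b → embed S a b ≡ true → Σ[ p ∈ a < n ] Σ[ q ∈ b < n ] S (fromℕ< p , fromℕ< q) ≡ true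
  embed-point S a b e with a <? n | b <? n
  ... | yes p | yes q = p , q , e

  embed-supported : ∀ (S : VSet n) → Supported (embed S)
  embed-supported S a b e with embed-point S a b e
  ... | p , q , _ = p , q

  odd-+ : ∀ x y → odd (x + y) ≡ odd x xor odd y
  odd-+ zero y = refl
  odd-+ (suc x) y = trans (cong not (odd-+ x y)) (not-distribˡ-xor (odd x) (odd y))

  odd-sucʳ : ∀ a b → odd (a + suc b) ≡ not (odd (a + b))
  odd-sucʳ a b rewrite +-suc a b = refl

  -- Defs uses 1-based coordinates, which does not change parities
  even-suc-suc : ∀ a b → evenᵇ (suc a + suc b) ≡ evenᵇ (a + b)
  even-suc-suc a b rewrite +-suc a b = not-involutive _

  even-not-odd : ∀ k → evenᵇ k ≡ true → odd k ≡ true → ⊥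
  even-not-odd k ev od with evenᵇ k
  even-not-odd k refl () | true

  embed-even : (S : VSet n) → S ⊆ V₁ → ∀ c e → embed S c e ≡ true → evenᵇ (c + e) ≡ true
  embed-even S S⊆V₁ c e h with embed-point S c e h
  ... | p , q , x = trans (sym (even-suc-suc c e))
                          (subst₂ (λ u w → evenᵇ (suc u + suc w) ≡ true) (toℕ-fromℕ< p) (toℕ-fromℕ< q) (S⊆V₁ _ x))

  ⊆V₁-odd : ∀ (Q : VSet n) → Q ⊆ V₁ → ∀ i j → evenᵇ (toℕ i + toℕ j) ≡ false → Q (i , j) ≡ false
  ⊆V₁-odd Q Q⊆V₁ i j ev =
    not-true (λ Qij → false≢true (trans (sym ev) (trans (sym (even-suc-suc (toℕ i) (toℕ j))) (Q⊆V₁ _ Qij))))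
    where
    false≢true : false ≡ true → ⊥
    false≢true ()

  adjacent : ℕ → ℕ → ℕ → ℕ → Bool
  adjacent c e a b = (∣ c - a ∣ + ∣ e - b ∣) ≡ᵇ 1

  ∣suc-∣≡1 : ∀ a → ∣ suc a - a ∣ ≡ 1
  ∣suc-∣≡1 zero = refl
  ∣suc-∣≡1 (suc a) = ∣suc-∣≡1 a

  ∣-suc∣≡1 : ∀ a → ∣ a - suc a ∣ ≡ 1
  ∣-suc∣≡1 zero = refl
  ∣-suc∣≡1 (suc a) = ∣-suc∣≡1 a

  ∣-∣≡1 : ∀ x y → ∣ x - y ∣ ≡ 1 → x ≡ suc y ⊎ suc x ≡ y
  ∣-∣≡1 zero y e = inj₂ (sym e)
  ∣-∣≡1 (suc x) zero e = inj₁ e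
  ∣-∣≡1 (suc x) (suc y) e with ∣-∣≡1 x y e
  ... | inj₁ p = inj₁ (cong suc p)
  ... | inj₂ p = inj₂ (cong suc p)

  +≡1 : ∀ x y → x + y ≡ 1 → (x ≡ 0 × y ≡ 1) ⊎ (x ≡ 1 × y ≡ 0)
  +≡1 zero y e = inj₁ (refl , e)
  +≡1 (suc zero) zero e = inj₂ (refl , refl)

  hasNeighbour-intro : ∀ X c e a b → X c e ≡ true → adjacent c e a b ≡ true → hasNeighbour X a b ≡ true
  hasNeighbour-intro X c e a b x adj with +≡1 ∣ c - a ∣ ∣ e - b ∣ (≡ᵇ-sound _ 1 adj)
  ... | inj₁ (c≡a , e~b) with ∣m-n∣≡0⇒m≡n {c} {a} c≡a | ∣-∣≡1 e b e~b
  ...   | refl | inj₁ refl = ∨-inr (below X c b ∨ left X c b) (∨-inr (X (suc c) b) x)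
  ...   | refl | inj₂ refl = ∨-inl (X (suc c) (suc e) ∨ X c (suc (suc e))) (∨-inl (left X c (suc e)) x)
  hasNeighbour-intro X c e a b x adj | inj₂ (c~a , e≡b) with ∣m-n∣≡0⇒m≡n {e} {b} e≡b | ∣-∣≡1 c a c~a
  ...   | refl | inj₁ refl = ∨-inr (below X a e ∨ left X a e) (∨-inl (X a (suc e)) x)
  ...   | refl | inj₂ refl = ∨-inl (X (suc (suc c)) e ∨ X (suc c) (suc e)) (∨-inr (below X (suc c) e) x)

  hasNeighbour-witness : ∀ X a b → hasNeighbour X a b ≡ true →
    Σ[ c ∈ ℕ ] Σ[ e ∈ ℕ ] (X c e ≡ true × adjacent c e a b ≡ true × odd (c + e) ≡ not (odd (a + b)))
  hasNeighbour-witness X a b h with below X a b in e₁ | left X a b in e₂ | X (suc a) b in e₃ | X a (suc b) in e₄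
  hasNeighbour-witness X a (suc b) h | true | _ | _ | _ =
    a , b , e₁ , ≡ᵇ-true (cong₂ _+_ (∣n-n∣≡0 a) (∣-suc∣≡1 b)) , trans (sym (not-involutive _)) (cong not (sym (odd-sucʳ a b)))
  hasNeighbour-witness X (suc a) b h | false | true | _ | _ =
    a , b , e₂ , ≡ᵇ-true (cong₂ _+_ (∣-suc∣≡1 a) (∣n-n∣≡0 b)) , sym (not-involutive _)
  hasNeighbour-witness X a b h | false | false | true | _ =
    suc a , b , e₃ , ≡ᵇ-true (cong₂ _+_ (∣suc-∣≡1 a) (∣n-n∣≡0 b)) , refl
  hasNeighbour-witness X a b h | false | false | false | true =
    a , suc b , e₄ , ≡ᵇ-true (cong₂ _+_ (∣n-n∣≡0 a) (∣suc-∣≡1 b)) , odd-sucʳ a b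

  hasNeighbour-as-count : ∀ X → Supported X → ∀ a b →
    (0 <ᵇ Σ< n (λ c → Σ< n (λ e → ⟦ X c e ∧ adjacent c e a b ⟧))) ≡ hasNeighbour X a b
  hasNeighbour-as-count X supp a b = bool-≡ to from
    where
    to : _ → hasNeighbour X a b ≡ true
    to h with Σ<-positive n _ (<ᵇ-sound 0 _ h)
    ... | c , c<n , h₂ with Σ<-positive n (λ e → ⟦ X c e ∧ adjacent c e a b ⟧) h₂
    ...   | e , e<n , h₃ = hasNeighbour-intro X c e a b (proj₁ (∧-split (⟦⟧-positive h₃))) (proj₂ (∧-split (⟦⟧-positive h₃)))
    from : hasNeighbour X a b ≡ true → _
    from h with hasNeighbour-witness X a b h
    ... | c , e , x , adj , _ =
      <ᵇ-true (Σ<-term n _ c (proj₁ (supp c e x))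
                (Σ<-term n (λ e → ⟦ X c e ∧ adjacent c e a b ⟧) e (proj₂ (supp c e x))
                         (subst (λ z → 0 < ⟦ z ⟧) (sym (∧-intro x adj)) z<s)))

  anyᵇ-neighbour : (S : VSet n) → ∀ i j → anyᵇ (λ u → S u ∧ adjᵇ u (i , j)) (vertices n)
                                        ≡ hasNeighbour (embed S) (toℕ i) (toℕ j)
  anyᵇ-neighbour S i j =
    trans (anyᵇ-countᵇ _ (vertices n))
          (trans (cong (0 <ᵇ_) (count-vertices n _ (λ c e → embed S c e ∧ adjacent c e (toℕ i) (toℕ j))
                                                 (λ c e → cong (_∧ _) (sym (embed-toℕ S c e)))))
                 (hasNeighbour-as-count (embed S) (embed-supported S) (toℕ i) (toℕ j)))

  N-pointwise : (S : VSet n) → S ⊆ V₁ → ∀ i j →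
                N S (i , j) ≡ ((odd (toℕ i + toℕ j) xor false) ∧ hasNeighbour (embed S) (toℕ i) (toℕ j))
  N-pointwise S S⊆V₁ i j rewrite anyᵇ-neighbour S i j | xor-identityʳ (odd (toℕ i + toℕ j))
    with S (i , j) in Sij | odd (toℕ i + toℕ j) in oddij
  ... | true | true = ⊥-elim (even-not-odd (toℕ i + toℕ j) (trans (sym (even-suc-suc (toℕ i) (toℕ j))) (S⊆V₁ _ Sij)) oddij)
  ... | true | false = refl
  ... | false | true = refl
  ... | false | false = not-true even-has-no-neighbour
    where
    even-has-no-neighbour : hasNeighbour (embed S) (toℕ i) (toℕ j) ≡ true → ⊥
    even-has-no-neighbour h with hasNeighbour-witness (embed S) (toℕ i) (toℕ j) h
    ... | c , e , x , _ , parity = even-not-odd (c + e) (embed-even S S⊆V₁ c e x) (trans parity (cong not oddij))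

  δ-as-boundary : (S : VSet n) → S ⊆ V₁ → δ S ≡ boundary false (embed S)
  δ-as-boundary S S⊆V₁ = count-vertices n (N S) _ (N-pointwise S S⊆V₁)

  boundary-cong : ∀ d {X Y} → (∀ a b → X a b ≡ Y a b) → boundary d X ≡ boundary d Y
  boundary-cong d {X} {Y} X≡Y =
    Σ<-cong n (λ a _ → Σ<-cong n (λ b _ → cong (λ z → ⟦ (odd (a + b) xor d) ∧ z ⟧) (neighbours a b)))
    where
    below≡ : ∀ a b → below X a b ≡ below Y a b
    below≡ a zero = refl
    below≡ a (suc b) = X≡Y a b
    left≡ : ∀ a b → left X a b ≡ left Y a b
    left≡ zero b = refl
    left≡ (suc a) b = X≡Y a b
    neighbours : ∀ a b → hasNeighbour X a b ≡ hasNeighbour Y a b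
    neighbours a b = cong₂ _∨_ (cong₂ _∨_ (below≡ a b) (left≡ a b)) (cong₂ _∨_ (X≡Y (suc a) b) (X≡Y a (suc b)))

  shift-⊆V₁ : (same : Vertex n → Vertex n → Bool) (Q : VSet n) → Q ⊆ V₁ → shift same Q ⊆ V₁
  shift-⊆V₁ same Q Q⊆V₁ v h with evenᵇ (xc v + yc v) in ev
  ... | true = refl
  ... | false = trans (sym ev) (Q⊆V₁ v h)

  ≡ᵇ-1-based : ∀ c e a b → (suc c + suc e ≡ᵇ suc a + suc b) ≡ (c + e ≡ᵇ a + b)
  ≡ᵇ-1-based c e a b rewrite +-suc c e | +-suc a b = refl

  downRight-point : ∀ (Q : VSet n) → Q ⊆ V₁ → ∀ i j → downRight Q (i , j) ≡ shiftDiag false (embed Q) (toℕ i) (toℕ j)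
  downRight-point Q Q⊆V₁ i j
    rewrite <ᵇ-true (toℕ<n i) | <ᵇ-true (toℕ<n j) | xor-identityʳ (odd (toℕ i + toℕ j))
          | not-involutive (evenᵇ (toℕ i + toℕ j)) | even-suc-suc (toℕ i) (toℕ j)
    with evenᵇ (toℕ i + toℕ j) in ev
  ... | true = cong₂ _<ᵇ_
          (count-vertices n _ _ (λ c e → cong (_∧ (toℕ e <ᵇ toℕ j)) (≡ᵇ-1-based (toℕ c) (toℕ e) (toℕ i) (toℕ j))))
          (count-vertices n _ _ (λ c e → cong₂ _∧_ (≡ᵇ-1-based (toℕ c) (toℕ e) (toℕ i) (toℕ j)) (sym (embed-toℕ Q c e))))
  ... | false = ⊆V₁-odd Q Q⊆V₁ i j ev

  embed-ext : ∀ (S : VSet n) (Y : Plane) → Supported Y →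
              (∀ i j → S (i , j) ≡ Y (toℕ i) (toℕ j)) → ∀ a b → embed S a b ≡ Y a b
  embed-ext S Y supp S≡Y a b with a <? n | b <? n
  ... | yes p | yes q = trans (S≡Y (fromℕ< p) (fromℕ< q)) (cong₂ Y (toℕ-fromℕ< p) (toℕ-fromℕ< q))
  ... | yes p | no q = sym (not-true (λ e → q (proj₂ (supp a b e))))
  ... | no p | _ = sym (not-true (λ e → p (proj₁ (supp a b e))))

  downRight-embed : ∀ (Q : VSet n) → Q ⊆ V₁ → ∀ a b → embed (downRight Q) a b ≡ shiftDiag false (embed Q) a b
  downRight-embed Q Q⊆V₁ = embed-ext (downRight Q) _ (shiftDiag-supported false _) (downRight-point Q Q⊆V₁)

  -- the reflection (a, b) ↦ (n - 1 - a, b), mapping W-lines to U-lines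

  reflect : Plane → Plane
  reflect X a b = (a <ᵇ n) ∧ X (n ∸ suc a) b

  reflect-supported : ∀ X → Supported X → Supported (reflect X)
  reflect-supported X supp a b e = <ᵇ-sound a n (proj₁ (∧-split e)) , proj₂ (supp _ b (proj₂ (∧-split e)))

  mirror<n : ∀ x → x < n → n ∸ suc x < n
  mirror<n x x<n = <-≤-trans (∸-monoʳ-< {n} {suc x} {x} (n<1+n x) x<n) (m∸n≤m n x)

  suc-mirror : ∀ x → x < n → suc (n ∸ suc x) ≡ n ∸ x
  suc-mirror x x<n = sym (+-∸-assoc 1 {n} {suc x} x<n)

  mirror-involutive : ∀ x → x < n → n ∸ suc (n ∸ suc x) ≡ x
  mirror-involutive x x<n = trans (cong (n ∸_) (suc-mirror x x<n)) (m∸[m∸n]≡n (<⇒≤ x<n))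

  mirror-+ : ∀ a → a < n → (n ∸ suc a) + a ≡ pred n
  mirror-+ a a<n = cong pred (trans (sym (+-suc (n ∸ suc a) a)) (m∸n+n≡m a<n))

  -- reflecting exchanges the left and right neighbours
  hasNeighbour-reflect : ∀ Y → Supported Y → ∀ a b → a < n → hasNeighbour (reflect Y) (n ∸ suc a) b ≡ hasNeighbour Y a b
  hasNeighbour-reflect Y supp a b a<n =
    trans (cong₂ _∨_ (cong₂ _∨_ (below≡ b) left≡) (cong₂ _∨_ right≡ (column (suc b))))
          (∨-interchange (below Y a b) (Y (suc a) b) (left Y a b) (Y a (suc b)))
    where
    a' = n ∸ suc a
    column : ∀ c → reflect Y a' c ≡ Y a c
    column c rewrite <ᵇ-true (mirror<n a a<n) | mirror-involutive a a<n = refl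
    below≡ : ∀ b → below (reflect Y) a' b ≡ below Y a b
    below≡ zero = refl
    below≡ (suc b) = column b
    left≡ : left (reflect Y) a' b ≡ Y (suc a) b
    left≡ with n ∸ suc a in a'≡
    ... | zero = sym (not-true (λ e → <⇒≱ (proj₁ (supp _ _ e)) (m∸n≡0⇒m≤n a'≡)))
    ... | suc a'' rewrite <ᵇ-true {a''} {n} (≤-trans (n≤1+n (suc a'')) (subst (λ z → suc z ≤ n) a'≡ (mirror<n a a<n))) =
          cong (λ z → Y z b) (trans (cong (n ∸_) (sym a'≡)) (m∸[m∸n]≡n a<n))
    right≡ : reflect Y (suc a') b ≡ left Y a b
    right≡ = right≡′ a a<n
      where
      right≡′ : ∀ a → a < n → reflect Y (suc (n ∸ suc a)) b ≡ left Y a b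
      right≡′ zero a<n rewrite suc-mirror 0 a<n = cong (_∧ Y (n ∸ suc n) b) (<ᵇ-false {n} {n} (<-irrefl refl))
      right≡′ (suc a) a<n rewrite suc-mirror (suc a) a<n | <ᵇ-true (mirror<n a (<-trans (n<1+n a) a<n))
                                | mirror-involutive a (<-trans (n<1+n a) a<n) = refl

  xor-cancel : ∀ x y z → (x xor y) xor (z xor x) ≡ z xor y
  xor-cancel true true true = refl
  xor-cancel true true false = refl
  xor-cancel true false true = refl
  xor-cancel true false false = refl
  xor-cancel false true true = refl
  xor-cancel false true false = refl
  xor-cancel false false true = refl
  xor-cancel false false false = refl

  odd-reflect : ∀ a b → a < n → odd ((n ∸ suc a) + b) ≡ odd (a + b) xor odd (pred n)
  odd-reflect a b a<n = begin
      odd (a' + b)                              ≡⟨ odd-+ a' b ⟩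
      odd a' xor odd b                          ≡⟨ sym (xor-cancel (odd a) (odd b) (odd a')) ⟩
      (odd a xor odd b) xor (odd a' xor odd a)  ≡⟨ sym (cong₂ _xor_ (odd-+ a b) (odd-+ a' a)) ⟩
      odd (a + b) xor odd (a' + a)              ≡⟨ cong (λ z → odd (a + b) xor odd z) (mirror-+ a a<n) ⟩
      odd (a + b) xor odd (pred n)              ∎
    where
    open ≡-Reasoning
    a' = n ∸ suc a

  boundary-reflect : ∀ d Y → Supported Y → boundary d (reflect Y) ≡ boundary (d xor odd (pred n)) Y
  boundary-reflect d Y supp =
    trans (sym (Σ<-reverse n (λ a → Σ< n (λ b → ⟦ (odd (a + b) xor d) ∧ hasNeighbour (reflect Y) a b ⟧))))
          (Σ<-cong n (λ a a<n → Σ<-cong n (λ b _ →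
             cong₂ (λ u v → ⟦ u ∧ v ⟧) (class a b a<n) (hasNeighbour-reflect Y supp a b a<n))))
    where
    class : ∀ a b → a < n → (odd ((n ∸ suc a) + b) xor d) ≡ (odd (a + b) xor (d xor odd (pred n)))
    class a b a<n = trans (cong (_xor d) (odd-reflect a b a<n))
                          (trans (xor-assoc (odd (a + b)) (odd (pred n)) d) (cong (odd (a + b) xor_) (xor-comm (odd (pred n)) d)))

  cross-sum : ∀ x k y a b e → x + k ≡ y + a → x + b ≡ a + e → k + e ≡ y + b
  cross-sum x k y a b e balance xb≡ae = +-cancelʳ-≡ a (k + e) (y + b) (begin
      k + e + a    ≡⟨ +-assoc k e a ⟩
      k + (e + a)  ≡⟨ cong (k +_) (+-comm e a) ⟩
      k + (a + e)  ≡⟨ cong (k +_) (sym xb≡ae) ⟩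
      k + (x + b)  ≡⟨ sym (+-assoc k x b) ⟩
      k + x + b    ≡⟨ cong (_+ b) (trans (+-comm k x) balance) ⟩
      y + a + b    ≡⟨ +-assoc y a b ⟩
      y + (a + b)  ≡⟨ cong (y +_) (+-comm a b) ⟩
      y + (b + a)  ≡⟨ sym (+-assoc y b a) ⟩
      y + b + a    ∎)
    where open ≡-Reasoning

  -- (k', e) lies on the W-line of (a, b) iff (k, e) lies on the U-line of (a', b),
  -- where ' denotes the mirror image x ↦ n - 1 - x
  sameW-reflect : ∀ a b k e → a < n → k < n → ((n ∸ suc k) + b ≡ᵇ a + e) ≡ (k + e ≡ᵇ (n ∸ suc a) + b)
  sameW-reflect a b k e a<n k<n =
    bool-≡ (λ h → ≡ᵇ-true (cross-sum _ k _ a b e balance (≡ᵇ-sound _ _ h)))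
           (λ h → ≡ᵇ-true (cross-sum k _ a _ e b (trans (+-comm k _) (trans balance (+-comm _ a))) (≡ᵇ-sound _ _ h)))
    where
    balance : (n ∸ suc k) + k ≡ (n ∸ suc a) + a
    balance = trans (mirror-+ k k<n) (sym (mirror-+ a a<n))

  xor-twice : ∀ x y → (x xor y) xor y ≡ x
  xor-twice x y = trans (xor-assoc x y y) (trans (cong (x xor_) (xor-same y)) (xor-identityʳ x))

  -- the parity class of U-lines that the reflection maps to even W-lines
  mirrorClass : Bool
  mirrorClass = odd (pred n)

  downLeft-point : ∀ (Q : VSet n) → Q ⊆ V₁ → ∀ i j →
                   downLeft Q (i , j) ≡ reflect (shiftDiag mirrorClass (reflect (embed Q))) (toℕ i) (toℕ j)
  downLeft-point Q Q⊆V₁ i j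
    rewrite <ᵇ-true (toℕ<n i) | <ᵇ-true (mirror<n (toℕ i) (toℕ<n i)) | <ᵇ-true (toℕ<n j)
          | odd-reflect (toℕ i) (toℕ j) (toℕ<n i) | xor-twice (odd (toℕ i + toℕ j)) mirrorClass
          | not-involutive (evenᵇ (toℕ i + toℕ j)) | even-suc-suc (toℕ i) (toℕ j)
    with evenᵇ (toℕ i + toℕ j) in ev
  ... | true = cong₂ _<ᵇ_ rank≡ diagSize≡
    where
    a = toℕ i
    b = toℕ j
    on-line : ∀ k e → k < n → ((n ∸ suc k) + b ≡ᵇ a + e) ≡ (k + e ≡ᵇ (n ∸ suc a) + b)
    on-line k e k<n = sameW-reflect a b k e (toℕ<n i) k<n
    rank≡ = trans (count-vertices n _ (λ c e → (c + b ≡ᵇ a + e) ∧ (e <ᵇ b))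
                    (λ c e → cong (_∧ (toℕ e <ᵇ b)) (≡ᵇ-1-based (toℕ c) b a (toℕ e))))
                  (trans (sym (Σ<-reverse n _))
                         (Σ<-cong n (λ k k<n → Σ<-cong n (λ e _ → cong (λ z → ⟦ z ∧ (e <ᵇ b) ⟧) (on-line k e k<n)))))
    diagSize≡ = trans (count-vertices n _ (λ c e → (c + b ≡ᵇ a + e) ∧ embed Q c e)
                        (λ c e → cong₂ _∧_ (≡ᵇ-1-based (toℕ c) b a (toℕ e)) (sym (embed-toℕ Q c e))))
                      (trans (sym (Σ<-reverse n _))
                             (Σ<-cong n (λ k k<n → Σ<-cong n (λ e _ →
                                cong₂ (λ z w → ⟦ z ∧ w ⟧) (on-line k e k<n) (cong (_∧ embed Q (n ∸ suc k) e) (sym (<ᵇ-true k<n)))))))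
  ... | false = ⊆V₁-odd Q Q⊆V₁ i j ev

  downLeft-embed : ∀ (Q : VSet n) → Q ⊆ V₁ → ∀ a b →
                   embed (downLeft Q) a b ≡ reflect (shiftDiag mirrorClass (reflect (embed Q))) a b
  downLeft-embed Q Q⊆V₁ =
    embed-ext (downLeft Q) _ (reflect-supported _ (shiftDiag-supported mirrorClass _)) (downLeft-point Q Q⊆V₁)


lemma4 : (n : ℕ) (Q : VSet n) → Q ⊆ V₁ →
    (δ (downRight Q) ≤ δ Q) × (δ (downLeft Q) ≤ δ Q)
lemma4 n Q Q⊆V₁ = down-right , down-left
  where
  open VertexSets n
  open Grid n using (boundary; shiftDiag; shiftDiag-supported; shiftDiag-boundary)
  open import Data.Bool using (false; _xor_)
  open import Data.Bool.Properties using (xor-same)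
  open import Relation.Binary.PropositionalEquality using (sym; cong)
  open import Data.Nat.Properties using (module ≤-Reasoning)
  open ≤-Reasoning

  X = embed Q
  X̃ = reflect X

  down-right : δ (downRight Q) ≤ δ Q
  down-right = begin
      δ (downRight Q)                      ≡⟨ δ-as-boundary (downRight Q) (shift-⊆V₁ sameUᵇ Q Q⊆V₁) ⟩
      boundary false (embed (downRight Q)) ≡⟨ boundary-cong false (downRight-embed Q Q⊆V₁) ⟩
      boundary false (shiftDiag false X)   ≤⟨ shiftDiag-boundary false X (embed-supported Q) ⟩
      boundary false X                     ≡⟨ sym (δ-as-boundary Q Q⊆V₁) ⟩
      δ Q                                  ∎

  down-left : δ (downLeft Q) ≤ δ Q
  down-left = begin
      δ (downLeft Q)                                       ≡⟨ δ-as-boundary (downLeft Q) (shift-⊆V₁ sameWᵇ Q Q⊆V₁) ⟩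
      boundary false (embed (downLeft Q))                  ≡⟨ boundary-cong false (downLeft-embed Q Q⊆V₁) ⟩
      boundary false (reflect (shiftDiag mirrorClass X̃))   ≡⟨ boundary-reflect false _ (shiftDiag-supported mirrorClass X̃) ⟩
      boundary mirrorClass (shiftDiag mirrorClass X̃)       ≤⟨ shiftDiag-boundary mirrorClass X̃ (reflect-supported X (embed-supported Q)) ⟩
      boundary mirrorClass X̃                               ≡⟨ boundary-reflect mirrorClass X (embed-supported Q) ⟩
      boundary (mirrorClass xor mirrorClass) X             ≡⟨ cong (λ d → boundary d X) (xor-same mirrorClass) ⟩
      boundary false X                                     ≡⟨ sym (δ-as-boundary Q Q⊆V₁) ⟩
      δ Q                                                  ∎
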